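{- Let $p=6m-1\ge11$ be a prime number and $n\ge1$. If $A\subseteq\mathbb{F}_p^n$ is structured, then there is no $B\in\widetilde{\mathrm{SF}}_0(\mathbb{F}_p^n)$ with $A\subseteq B$.
   Context: A subset of an abelian group is sum-free if it contains no $x,y,z$ with $x+y=z$. $\widetilde{\mathrm{SF}}_0(\mathbb{F}_p^n)$ denotes the set of sum-free subsets of $\mathbb{F}_p^n$ of maximum possible size among all sum-free subsets of $\mathbb{F}_p^n$. Two subsets of an abelian group $G$ are isomorphic if some group automorphism of $G$ maps one onto the other. Elements of $\mathbb{F}_p$ are identified with residues of integers mod $p$, and for integers $a\le b$, $[a,b]$ denotes $\{a,\dots,b\}$ reduced mod $p$; $\mathbb{F}_p^n$ is identified with $\mathbb{F}_p\times\mathbb{F}_p^{n-1}$ (with $\mathbb{F}_p^0=\{0\}$). A set $A\subseteq\mathbb{F}_p^n$ is very structured if there is a (possibly empty) set $P\subseteq\mathbb{F}_p^{n-1}$ with $0\notin P+P$ such that $A$ is isomorphic to \[ \{(2m-1,0)\}\cup \{2m\}\times(\mathbb{F}_p^{n-1}\setminus P)\cup[2m+1,4m-3]\times\mathbb{F}_p^{n-1}\cup\{4m-2\}\times(\mathbb{F}_p^{n-1}\setminus\{0\})\cup\{4m-1\}\times P . \] A set $A\subseteq\mathbb{F}_p^n$ is structured if there exist $\ell\in\{1,\dots,n\}$ and a very structured $B\subseteq\mathbb{F}_p^\ell$ such that $A$ is isomorphic to $B\times\mathbb{F}_p^{n-\ell}$. -}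

module Defs where

open import Data.Nat using (ℕ; zero; suc; _+_; _*_; _∸_; _≤_; NonZero)
open import Data.Nat.DivMod using (_mod_)
open import Data.Fin using (Fin; toℕ)
open import Data.Vec using (Vec; []; _∷_; zipWith; replicate; take; cast)
open import Data.Nat.ListAction using (sum)
open import Data.List using (List; concatMap; map; allFin) renaming ([] to []ₗ; _∷_ to _∷ₗ_)
open import Data.Bool using (Bool; true; false; if_then_else_)
open import Data.Product using (Σ; _×_; ∃; ∃-syntax)
open import Data.Sum using (_⊎_)
open import Relation.Binary.PropositionalEquality using (_≡_)
open import Relation.Nullary using (¬_)
open import Function.Bundles using (_⇔_)

module _ (p : ℕ) .{{_ : NonZero p}} where

  Fp : Set
  Fp = Fin p

  [_]ₚ : ℕ → Fp
  [ a ]ₚ = a mod p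

  _+F_ : Fp → Fp → Fp
  a +F b = (toℕ a + toℕ b) mod p

  V : ℕ → Set
  V n = Vec Fp n

  _+V_ : {n : ℕ} → V n → V n → V n
  x +V y = zipWith _+F_ x y

  0V : (n : ℕ) → V n
  0V n = replicate n [ 0 ]ₚ

  -- subsets with decidable membership (used for sum-free sets and cardinality)
  BSubset : ℕ → Set
  BSubset n = V n → Bool

  allV : (n : ℕ) → List (V n)
  allV zero = [] ∷ₗ []ₗ
  allV (suc n) = concatMap (λ a → map (a ∷_) (allV n)) (allFin p)

  card : {n : ℕ} → BSubset n → ℕ
  card {n} S = sum (map (λ x → if S x then 1 else 0) (allV n))

  SumFree : {n : ℕ} → BSubset n → Set
  SumFree S = ∀ x y → S x ≡ true → S y ≡ true → S (x +V y) ≡ false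

  MaxSumFree : {n : ℕ} → BSubset n → Set
  MaxSumFree {n} B = SumFree B × (∀ (C : BSubset n) → SumFree C → card C ≤ card B)

  record Aut (n : ℕ) : Set where
    field
      fun  : V n → V n
      inv  : V n → V n
      fun∘inv : ∀ y → fun (inv y) ≡ y
      inv∘fun : ∀ x → inv (fun x) ≡ x
      hom  : ∀ x y → fun (x +V y) ≡ fun x +V fun y

  Isomorphic : {n : ℕ} → (V n → Set) → (V n → Set) → Set
  Isomorphic {n} A B = Σ (Aut n) λ φ → ∀ x → A x ⇔ B (Aut.fun φ x)

  VSModel : (m k : ℕ) → (V k → Set) → V (suc k) → Set
  VSModel m k P (a ∷ v) =
       (a ≡ [ 2 * m ∸ 1 ]ₚ × v ≡ 0V k)
     ⊎ (a ≡ [ 2 * m ]ₚ × ¬ P v)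
     ⊎ (∃[ i ] (2 * m + 1 ≤ i × i ≤ 4 * m ∸ 3 × a ≡ [ i ]ₚ))
     ⊎ (a ≡ [ 4 * m ∸ 2 ]ₚ × ¬ (v ≡ 0V k))
     ⊎ (a ≡ [ 4 * m ∸ 1 ]ₚ × P v)

  ZeroNotInSumset : {k : ℕ} → (V k → Set) → Set
  ZeroNotInSumset {k} P = ∀ x y → P x → P y → ¬ (x +V y ≡ 0V k)

  VeryStructured : (m k : ℕ) → (V (suc k) → Set) → Set₁
  VeryStructured m k B =
    Σ (V k → Set) λ P → ZeroNotInSumset P × Isomorphic B (VSModel m k P)

  -- A ≅ B × F_p^{n-ℓ} with ℓ = suc k ∈ {1..n} and B very structured in F_p^ℓ
  Structured : (m n : ℕ) → (V n → Set) → Set₁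
  Structured m n A =
    Σ ℕ λ k → Σ ℕ λ r → Σ (n ≡ suc k + r) λ eq →
    Σ (V (suc k) → Set) λ B →
      VeryStructured m k B × Isomorphic A (λ x → B (take (suc k) (cast eq x)))

-- Up to an automorphism, a maximum sum-free set D containing a structured set contains
-- (2m-1, 0), (2m, 0) and the slab [2m+1, 4m-3] × F_p^{n-1}. Sum-freeness then confines D to the
-- hyperplanes x₁ ∈ [2m-1, 4m-1], and for x₁ ∈ {2m-1, 2m} at most one of x and x + (2m-1, 0)
-- lies in D; so |D| ≤ (2m-1) p^{n-1}. But the middle third [2m, 4m-1] × F_p^{n-1} is sum-free
-- of size 2m p^{n-1}, contradicting the maximality of D.
module Submission where

open import Defs
open import Algebra.Definitions using (Associative; Commutative; RightIdentity)
import Algebra.Properties.CommutativeSemigroup as CommutativeSemigroupProperties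
open import Data.Bool using (Bool; true; false; _∧_; if_then_else_)
open import Data.Bool.Properties using (∧-zeroʳ; ¬-not; T-≡; T-∧)
open import Data.Empty using (⊥-elim)
open import Data.Fin using (Fin; toℕ)
open import Data.Fin.Properties using (toℕ-fromℕ<; toℕ-injective; toℕ<n)
open import Data.List using (List; []; _∷_; [_]; map; allFin)
open import Data.List.Properties using (map-∘)
open import Data.List.Membership.Propositional using (_∈_)
open import Data.List.Membership.Propositional.Properties
  using (∈-map⁺; ∈-map⁻; ∈-concat⁺′; ∈-allFin)
open import Data.List.Membership.Propositional.Properties.WithK using (unique∧set⇒bag)
open import Data.List.Relation.Binary.BagAndSetEquality using (∼bag⇒↭)
open import Data.List.Relation.Binary.Disjoint.Propositional using (Disjoint)
open import Data.List.Relation.Binary.Permutation.Propositional using (_↭_)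
import Data.List.Relation.Binary.Permutation.Propositional.Properties as ↭
open import Data.List.Relation.Unary.Any using (here; there)
import Data.List.Relation.Unary.All as All
import Data.List.Relation.Unary.All.Properties as All
import Data.List.Relation.Unary.AllPairs as AllPairs
import Data.List.Relation.Unary.AllPairs.Properties as AllPairs
open import Data.List.Relation.Unary.Unique.Propositional using (Unique)
import Data.List.Relation.Unary.Unique.Propositional.Properties as Unique
open import Data.Nat
  using (ℕ; zero; suc; _+_; _*_; _∸_; _≤_; _<_; _≤ᵇ_; _≟_; _≤?_; _<?_; _%_; NonZero;
         z≤n; s≤s; s≤s⁻¹; z<s; >-nonZero⁻¹)
open import Data.Nat.DivMod using (_mod_; m<n⇒m%n≡m; %-distribˡ-+; m%n%n≡m%n; [m+n]%n≡m%n; n%n≡0)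
open import Data.Nat.ListAction using (sum)
open import Data.Nat.ListAction.Properties using (sum-↭)
open import Data.Nat.Primality using (Prime)
open import Data.Nat.Properties
open import Data.Nat.Tactic.RingSolver using (solve)
open import Data.Product using (Σ; _×_; _,_; ∃-syntax)
open import Data.Sum using (inj₁; inj₂)
open import Data.Vec using (Vec; []; _∷_; head; take; drop; _++_; replicate; cast)
import Data.Vec.Properties as Vec
open import Function using (_∘_)
open import Function.Bundles using (_⇔_; mk⇔; Equivalence)
open import Relation.Binary.PropositionalEquality
  using (_≡_; _≢_; refl; sym; trans; cong; cong₂; subst; subst₂; module ≡-Reasoning)
open import Relation.Nullary using (¬_; yes; no)

open CommutativeSemigroupProperties +-commutativeSemigroup
  using () renaming (interchange to +-interchange)

ind : Bool → ℕ
ind b = if b then 1 else 0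

ind≤1 : ∀ b → ind b ≤ 1
ind≤1 true  = ≤-refl
ind≤1 false = z≤n

ind-mono : ∀ {b₁ b₂} → (b₁ ≡ true → b₂ ≡ true) → ind b₁ ≤ ind b₂
ind-mono {false} _       = z≤n
ind-mono {true}  b₁⇒b₂ rewrite b₁⇒b₂ refl = ≤-refl

ind-∧-mono : ∀ {b₁ b₂} c → (b₁ ≡ true → b₂ ≡ true) → ind (b₁ ∧ c) ≤ ind (b₂ ∧ c)
ind-∧-mono {false} c _       = z≤n
ind-∧-mono {true}  c b₁⇒b₂ rewrite b₁⇒b₂ refl = ≤-refl

≰⇒≤ᵇ≡false : ∀ {m n} → ¬ m ≤ n → (m ≤ᵇ n) ≡ false
≰⇒≤ᵇ≡false {m} {n} m≰n = ¬-not (m≰n ∘ ≤ᵇ⇒≤ m n ∘ Equivalence.from T-≡)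

infix 5 _∈[_,_]

-- Opaque, so that the bounds of an interval test are recovered by unification
-- instead of disappearing into the reduction of _≤ᵇ_.
opaque
  _∈[_,_] : ℕ → ℕ → ℕ → Bool
  t ∈[ lo , hi ] = (lo ≤ᵇ t) ∧ (t ≤ᵇ hi)

  ∈[]-intro : ∀ {t lo hi} → lo ≤ t → t ≤ hi → t ∈[ lo , hi ] ≡ true
  ∈[]-intro lo≤t t≤hi = Equivalence.to T-≡ (Equivalence.from T-∧ (≤⇒≤ᵇ lo≤t , ≤⇒≤ᵇ t≤hi))

  ∈[]-below : ∀ {t lo hi} → t < lo → t ∈[ lo , hi ] ≡ false
  ∈[]-below t<lo rewrite ≰⇒≤ᵇ≡false (<⇒≱ t<lo) = refl

  ∈[]-above : ∀ {t lo hi} → hi < t → t ∈[ lo , hi ] ≡ false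
  ∈[]-above hi<t rewrite ≰⇒≤ᵇ≡false (<⇒≱ hi<t) = ∧-zeroʳ _

  ∈[]-bounds : ∀ {t lo hi} → t ∈[ lo , hi ] ≡ true → lo ≤ t × t ≤ hi
  ∈[]-bounds {t} {lo} {hi} t∈ with Equivalence.to T-∧ (Equivalence.from T-≡ t∈)
  ... | lo≤ᵇt , t≤ᵇhi = ≤ᵇ⇒≤ lo t lo≤ᵇt , ≤ᵇ⇒≤ t hi t≤ᵇhi

module _ {A : Set} where

  sum-map-mono : ∀ (xs : List A) {f g : A → ℕ} → (∀ x → f x ≤ g x) → sum (map f xs) ≤ sum (map g xs)
  sum-map-mono []       _   = z≤n
  sum-map-mono (x ∷ xs) f≤g = +-mono-≤ (f≤g x) (sum-map-mono xs f≤g)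

  sum-map-mono-< : ∀ {xs : List A} {f g : A → ℕ} → (∀ x → f x ≤ g x) →
                   ∀ {y} → y ∈ xs → f y < g y → sum (map f xs) < sum (map g xs)
  sum-map-mono-< {_ ∷ xs} f≤g (here refl) fy<gy = +-mono-<-≤ fy<gy (sum-map-mono xs f≤g)
  sum-map-mono-< {x ∷ _}  f≤g (there y∈xs) fy<gy = +-mono-≤-< (f≤g x) (sum-map-mono-< f≤g y∈xs fy<gy)

  sum-map-+ : ∀ (xs : List A) (f g : A → ℕ) →
              sum (map (λ x → f x + g x) xs) ≡ sum (map f xs) + sum (map g xs)
  sum-map-+ []       f g = refl
  sum-map-+ (x ∷ xs) f g =
    trans (cong (f x + g x +_) (sum-map-+ xs f g)) (+-interchange (f x) (g x) _ _)

module _ {A : Set} where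

  take-++ : ∀ m {n} (xs : Vec A m) (ys : Vec A n) → take m (xs ++ ys) ≡ xs
  take-++ zero    []       ys = refl
  take-++ (suc m) (x ∷ xs) ys = cong (x ∷_) (take-++ m xs ys)

  drop-++ : ∀ m {n} (xs : Vec A m) (ys : Vec A n) → drop m (xs ++ ys) ≡ ys
  drop-++ zero    []       ys = refl
  drop-++ (suc m) (x ∷ xs) ys = drop-++ m xs ys

  take-replicate : ∀ m {n} (a : A) → take m (replicate (m + n) a) ≡ replicate m a
  take-replicate zero    a = refl
  take-replicate (suc m) a = cong (a ∷_) (take-replicate m a)

module Fpⁿ (p : ℕ) .{{_ : NonZero p}} where

  infixl 6 _⊕_ _⊞_

  _⊕_ : Fp p → Fp p → Fp p
  _⊕_ = _+F_ p

  _⊞_ : ∀ {n} → V p n → V p n → V p n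
  _⊞_ = _+V_ p

  ⟦_⟧ : ℕ → Fp p
  ⟦_⟧ = [_]ₚ p

  ∈-allV : ∀ {n} (x : V p n) → x ∈ allV p n
  ∈-allV []              = here refl
  ∈-allV {suc n} (a ∷ x) =
    ∈-concat⁺′ (∈-map⁺ (a ∷_) (∈-allV x)) (∈-map⁺ (λ a → map (a ∷_) (allV p n)) (∈-allFin a))

  allV-unique : ∀ n → Unique (allV p n)
  allV-unique zero    = All.[] AllPairs.∷ AllPairs.[]
  allV-unique (suc n) =
    Unique.concat⁺ (All.map⁺ (All.universal (λ _ → Unique.map⁺ Vec.∷-injectiveʳ (allV-unique n)) (allFin p)))
                   (AllPairs.map⁺ (AllPairs.map disjoint (Unique.allFin⁺ p)))
    where
    disjoint : ∀ {a b : Fin p} → a ≢ b → Disjoint (map (a ∷_) (allV p n)) (map (b ∷_) (allV p n))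
    disjoint a≢b (x∈ , y∈) with ∈-map⁻ _ x∈ | ∈-map⁻ _ y∈
    ... | _ , _ , refl | _ , _ , eq = a≢b (Vec.∷-injectiveˡ eq)

  sum-allV-reindex : ∀ {n} {f g : V p n → V p n} → (∀ x → f (g x) ≡ x) → (∀ x → g (f x) ≡ x) →
                     (h : V p n → ℕ) → sum (map h (allV p n)) ≡ sum (map (h ∘ f) (allV p n))
  sum-allV-reindex {n} {f} {g} f∘g g∘f h = begin
    sum (map h (allV p n))           ≡⟨ sym (sum-↭ (↭.map⁺ h f-permutes)) ⟩
    sum (map h (map f (allV p n)))   ≡⟨ cong sum (sym (map-∘ (allV p n))) ⟩
    sum (map (h ∘ f) (allV p n))     ∎
    where
    open ≡-Reasoning
    f-injective : ∀ {x y} → f x ≡ f y → x ≡ y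
    f-injective {x} {y} eq = trans (sym (g∘f x)) (trans (cong g eq) (g∘f y))
    f-permutes : map f (allV p n) ↭ allV p n
    f-permutes = ∼bag⇒↭ (unique∧set⇒bag (Unique.map⁺ f-injective (allV-unique n)) (allV-unique n)
      (λ {x} → mk⇔ (λ _ → ∈-allV x) (λ _ → subst (_∈ map f (allV p n)) (f∘g x) (∈-map⁺ f (∈-allV (g x))))))

  [m%p+o]%p≡[m+o]%p : ∀ m o → (m % p + o) % p ≡ (m + o) % p
  [m%p+o]%p≡[m+o]%p m o = begin
    (m % p + o) % p          ≡⟨ %-distribˡ-+ (m % p) o p ⟩
    (m % p % p + o % p) % p  ≡⟨ cong (λ r → (r + o % p) % p) (m%n%n≡m%n m p) ⟩
    (m % p + o % p) % p      ≡⟨ %-distribˡ-+ m o p ⟨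
    (m + o) % p              ∎
    where open ≡-Reasoning

  toℕ-⟦⟧ : ∀ {i} → i < p → toℕ ⟦ i ⟧ ≡ i
  toℕ-⟦⟧ i<p = trans (toℕ-fromℕ< _) (m<n⇒m%n≡m i<p)

  ⟦toℕ⟧ : ∀ a → ⟦ toℕ a ⟧ ≡ a
  ⟦toℕ⟧ a = toℕ-injective (toℕ-⟦⟧ (toℕ<n a))

  toℕ≡⇒≡⟦⟧ : ∀ {a i} → toℕ a ≡ i → a ≡ ⟦ i ⟧
  toℕ≡⇒≡⟦⟧ {a} refl = sym (⟦toℕ⟧ a)

  toℕ-⊕ : ∀ a b → toℕ (a ⊕ b) ≡ (toℕ a + toℕ b) % p
  toℕ-⊕ a b = toℕ-fromℕ< _

  toℕ-⊕-< : ∀ a b → toℕ a + toℕ b < p → toℕ (a ⊕ b) ≡ toℕ a + toℕ b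
  toℕ-⊕-< a b no-wrap = trans (toℕ-⊕ a b) (m<n⇒m%n≡m no-wrap)

  toℕ-⊕-≥ : ∀ a b → p ≤ toℕ a + toℕ b → toℕ (a ⊕ b) + p ≡ toℕ a + toℕ b
  toℕ-⊕-≥ a b wrap = begin
    toℕ (a ⊕ b) + p   ≡⟨ cong (_+ p) (toℕ-⊕ a b) ⟩
    s % p + p         ≡⟨ cong (λ x → x % p + p) r+p≡s ⟨
    (r + p) % p + p   ≡⟨ cong (_+ p) (trans ([m+n]%n≡m%n r p) (m<n⇒m%n≡m r<p)) ⟩
    r + p             ≡⟨ r+p≡s ⟩
    s                 ∎
    where
    open ≡-Reasoning
    s = toℕ a + toℕ b
    r = s ∸ p
    r+p≡s : r + p ≡ s
    r+p≡s = m∸n+n≡m wrap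
    r<p : r < p
    r<p = +-cancelʳ-< p r p (subst (_< p + p) (sym r+p≡s) (+-mono-< (toℕ<n a) (toℕ<n b)))

  toℕ-⊕-wrap : ∀ a b → p ≤ toℕ a + toℕ b → toℕ (a ⊕ b) < toℕ b
  toℕ-⊕-wrap a b wrap = +-cancelʳ-< p _ _
    (subst₂ _<_ (sym (toℕ-⊕-≥ a b wrap)) (+-comm p (toℕ b)) (+-monoˡ-< (toℕ b) (toℕ<n a)))

  ⊕-comm : Commutative _≡_ _⊕_
  ⊕-comm a b = cong (_mod p) (+-comm (toℕ a) (toℕ b))

  ⊕-assoc : Associative _≡_ _⊕_
  ⊕-assoc a b c = toℕ-injective (begin
    toℕ (a ⊕ b ⊕ c)              ≡⟨ toℕ-⊕-⊕ a b c ⟩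
    (toℕ a + toℕ b + toℕ c) % p  ≡⟨ cong (_% p) (trans (+-assoc (toℕ a) _ _) (+-comm (toℕ a) _)) ⟩
    (toℕ b + toℕ c + toℕ a) % p  ≡⟨ toℕ-⊕-⊕ b c a ⟨
    toℕ (b ⊕ c ⊕ a)              ≡⟨ cong toℕ (⊕-comm (b ⊕ c) a) ⟩
    toℕ (a ⊕ (b ⊕ c))            ∎)
    where
    open ≡-Reasoning
    toℕ-⊕-⊕ : ∀ a b c → toℕ (a ⊕ b ⊕ c) ≡ (toℕ a + toℕ b + toℕ c) % p
    toℕ-⊕-⊕ a b c = trans (toℕ-⊕ (a ⊕ b) c)
      (trans (cong (λ x → (x + toℕ c) % p) (toℕ-⊕ a b)) ([m%p+o]%p≡[m+o]%p _ _))

  ⊕-identityʳ : RightIdentity _≡_ ⟦ 0 ⟧ _⊕_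
  ⊕-identityʳ a = toℕ-injective (begin
    toℕ (a ⊕ ⟦ 0 ⟧)        ≡⟨ toℕ-⊕-< a ⟦ 0 ⟧ (subst (_< p) (sym toℕa+0≡toℕa) (toℕ<n a)) ⟩
    toℕ a + toℕ ⟦ 0 ⟧      ≡⟨ toℕa+0≡toℕa ⟩
    toℕ a                  ∎)
    where
    open ≡-Reasoning
    toℕa+0≡toℕa : toℕ a + toℕ ⟦ 0 ⟧ ≡ toℕ a
    toℕa+0≡toℕa = trans (cong (toℕ a +_) (toℕ-⟦⟧ (>-nonZero⁻¹ p))) (+-identityʳ (toℕ a))

  ⊕-≡⟦0⟧ : ∀ a b → toℕ a + toℕ b ≡ p → a ⊕ b ≡ ⟦ 0 ⟧
  ⊕-≡⟦0⟧ a b a+b≡p = toℕ-injective (begin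
    toℕ (a ⊕ b)           ≡⟨ toℕ-⊕ a b ⟩
    (toℕ a + toℕ b) % p   ≡⟨ cong (_% p) a+b≡p ⟩
    p % p                 ≡⟨ n%n≡0 p ⟩
    0                     ≡⟨ toℕ-⟦⟧ (>-nonZero⁻¹ p) ⟨
    toℕ ⟦ 0 ⟧             ∎)
    where open ≡-Reasoning

  ⊞-comm : ∀ {n} → Commutative _≡_ (_⊞_ {n})
  ⊞-comm = Vec.zipWith-comm ⊕-comm

  ⊞-assoc : ∀ {n} → Associative _≡_ (_⊞_ {n})
  ⊞-assoc = Vec.zipWith-assoc ⊕-assoc

  ⊞-identityʳ : ∀ {n} → RightIdentity _≡_ (0V p n) _⊞_
  ⊞-identityʳ = Vec.zipWith-identityʳ ⊕-identityʳ

  ⊞-cancelʳ : ∀ {n} {c d : V p n} → c ⊞ d ≡ 0V p n → ∀ x → x ⊞ c ⊞ d ≡ x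
  ⊞-cancelʳ {c = c} {d} c⊞d≡0 x = trans (⊞-assoc x c d) (trans (cong (x ⊞_) c⊞d≡0) (⊞-identityʳ x))

  axisPoint-⊞-≡0 : ∀ {n} c d → toℕ c + toℕ d ≡ p → (c ∷ 0V p n) ⊞ (d ∷ 0V p n) ≡ 0V p (suc n)
  axisPoint-⊞-≡0 c d c+d≡p = cong₂ _∷_ (⊕-≡⟦0⟧ c d c+d≡p) (⊞-identityʳ _)

  sum-allV-translate : ∀ {n} {c d : V p n} → c ⊞ d ≡ 0V p n →
                       (h : V p n → ℕ) → sum (map h (allV p n)) ≡ sum (map (λ x → h (x ⊞ c)) (allV p n))
  sum-allV-translate {c = c} {d} c⊞d≡0 =
    sum-allV-reindex (⊞-cancelʳ (trans (⊞-comm d c) c⊞d≡0)) (⊞-cancelʳ c⊞d≡0)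

  sumFree-excludes : ∀ {n} {S : BSubset p n} → SumFree p S →
                     ∀ {x y} → S y ≡ true → S (x ⊞ y) ≡ true → S x ≡ false
  sumFree-excludes {S = S} S-sumFree {x} {y} Sy Sx⊞y with S x in Sx
  ... | false = refl
  ... | true with trans (sym Sx⊞y) (S-sumFree x y Sx Sy)
  ...   | ()

  onPrefix : ∀ ℓ {r} → (V p ℓ → V p ℓ) → V p (ℓ + r) → V p (ℓ + r)
  onPrefix ℓ f x = f (take ℓ x) ++ drop ℓ x

  onPrefix-inverse : ∀ ℓ {r} {f g : V p ℓ → V p ℓ} → (∀ y → f (g y) ≡ y) →
                     ∀ (x : V p (ℓ + r)) → onPrefix ℓ f (onPrefix ℓ g x) ≡ x
  onPrefix-inverse ℓ {f = f} {g} f∘g x = begin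
    f (take ℓ (g (take ℓ x) ++ drop ℓ x)) ++ drop ℓ (g (take ℓ x) ++ drop ℓ x)
      ≡⟨ cong₂ _++_ (cong f (take-++ ℓ _ _)) (drop-++ ℓ _ _) ⟩
    f (g (take ℓ x)) ++ drop ℓ x  ≡⟨ cong (_++ drop ℓ x) (f∘g _) ⟩
    take ℓ x ++ drop ℓ x          ≡⟨ Vec.take++drop≡id ℓ x ⟩
    x                             ∎
    where open ≡-Reasoning

  onPrefix-hom : ∀ ℓ {r} {f : V p ℓ → V p ℓ} → (∀ x y → f (x ⊞ y) ≡ f x ⊞ f y) →
                 ∀ (x y : V p (ℓ + r)) → onPrefix ℓ f (x ⊞ y) ≡ onPrefix ℓ f x ⊞ onPrefix ℓ f y
  onPrefix-hom ℓ {f = f} f-hom x y = begin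
    f (take ℓ (x ⊞ y)) ++ drop ℓ (x ⊞ y)
      ≡⟨ cong₂ _++_ (trans (cong f (Vec.take-zipWith _ x y)) (f-hom _ _)) (Vec.drop-zipWith _ x y) ⟩
    (f (take ℓ x) ⊞ f (take ℓ y)) ++ (drop ℓ x ⊞ drop ℓ y)
      ≡⟨ Vec.zipWith-++ _ (f (take ℓ x)) (drop ℓ x) (f (take ℓ y)) (drop ℓ y) ⟨
    onPrefix ℓ f x ⊞ onPrefix ℓ f y
      ∎
    where open ≡-Reasoning

  Aut-inv-hom : ∀ {n} (φ : Aut p n) x y → Aut.inv φ (x ⊞ y) ≡ Aut.inv φ x ⊞ Aut.inv φ y
  Aut-inv-hom φ x y = begin
    inv (x ⊞ y)                      ≡⟨ cong inv (cong₂ _⊞_ (fun∘inv x) (fun∘inv y)) ⟨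
    inv (fun (inv x) ⊞ fun (inv y))  ≡⟨ cong inv (hom (inv x) (inv y)) ⟨
    inv (fun (inv x ⊞ inv y))        ≡⟨ inv∘fun _ ⟩
    inv x ⊞ inv y                    ∎
    where
    open ≡-Reasoning
    open Aut φ

  Aut-inverse : ∀ {n} → Aut p n → Aut p n
  Aut-inverse φ = record
    { fun = inv ; inv = fun ; fun∘inv = inv∘fun ; inv∘fun = fun∘inv ; hom = Aut-inv-hom φ }
    where open Aut φ

  infixr 9 _∘ᴬ_
  _∘ᴬ_ : ∀ {n} → Aut p n → Aut p n → Aut p n
  φ ∘ᴬ χ = record
    { fun     = φ.fun ∘ χ.fun
    ; inv     = χ.inv ∘ φ.inv
    ; fun∘inv = λ y → trans (cong φ.fun (χ.fun∘inv _)) (φ.fun∘inv y)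
    ; inv∘fun = λ x → trans (cong χ.inv (φ.inv∘fun _)) (χ.inv∘fun x)
    ; hom     = λ x y → trans (cong φ.fun (χ.hom x y)) (φ.hom _ _)
    }
    where
    module φ = Aut φ
    module χ = Aut χ

  Aut-onPrefix : ∀ ℓ {r} → Aut p ℓ → Aut p (ℓ + r)
  Aut-onPrefix ℓ φ = record
    { fun     = onPrefix ℓ fun
    ; inv     = onPrefix ℓ inv
    ; fun∘inv = onPrefix-inverse ℓ {f = fun} {inv} fun∘inv
    ; inv∘fun = onPrefix-inverse ℓ {f = inv} {fun} inv∘fun
    ; hom     = onPrefix-hom ℓ hom
    }
    where open Aut φ

  sumFree-∘Aut : ∀ {n} (φ : Aut p n) {S : BSubset p n} → SumFree p S → SumFree p (S ∘ Aut.fun φ)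
  sumFree-∘Aut φ {S} S-sumFree x y Sφx Sφy =
    subst (λ z → S z ≡ false) (sym (Aut.hom φ x y)) (S-sumFree _ _ Sφx Sφy)

  card-∘Aut : ∀ {n} (φ : Aut p n) (S : BSubset p n) → card p (S ∘ Aut.fun φ) ≡ card p S
  card-∘Aut φ S = sym (sum-allV-reindex (Aut.fun∘inv φ) (Aut.inv∘fun φ) (ind ∘ S))

  ⊇iso-product⇒∘Aut-⊇product : ∀ {ℓ r} {A : V p (ℓ + r) → Set} {B M : V p ℓ → Set} {S : BSubset p (ℓ + r)}
    (φ : Aut p (ℓ + r)) (χ : Aut p ℓ) →
    (∀ x → A x ⇔ B (take ℓ (cast refl (Aut.fun φ x)))) → (∀ y → B y ⇔ M (Aut.fun χ y)) →
    (∀ x → A x → S x ≡ true) →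
    Σ (Aut p (ℓ + r)) λ ψ → ∀ w → M (take ℓ w) → S (Aut.fun ψ w) ≡ true
  ⊇iso-product⇒∘Aut-⊇product {ℓ} {A = A} {B} {M} φ χ A≅B B≅M A⊆S =
    Aut-inverse φ ∘ᴬ Aut-onPrefix ℓ (Aut-inverse χ) , λ w → A⊆S _ ∘ A∋ w
    where
    module φ = Aut φ
    module χ = Aut χ
    A∋ : ∀ w → M (take ℓ w) → A (φ.inv (onPrefix ℓ χ.inv w))
    A∋ w Mw = Equivalence.from (A≅B _)
      (subst B (sym take-eq) (Equivalence.from (B≅M _) (subst M (sym (χ.fun∘inv _)) Mw)))
      where
      take-eq : take ℓ (cast refl (φ.fun (φ.inv (onPrefix ℓ χ.inv w)))) ≡ χ.inv (take ℓ w)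
      take-eq = trans (cong (take ℓ) (trans (Vec.cast-is-id refl _) (φ.fun∘inv _))) (take-++ ℓ _ _)

-- With m = 2 + q and Q = 2q, so that p = 6m - 1: 3 + Q = 2m - 1, 4 + Q = 2m, 5 + Q = 2m + 1,
-- 5 + 2Q = 4m - 3, 6 + 2Q = 4m - 2, 7 + 2Q = 4m - 1 and 10 + 3Q = p - 1.
module MiddleThird (p : ℕ) .{{_ : NonZero p}} (Q : ℕ) (p≡ : p ≡ 11 + (Q + (Q + Q))) where
  open Fpⁿ p

  private
    +Q≤+2Q : ∀ {a b} → a ≤ b → a + Q ≤ b + (Q + Q)
    +Q≤+2Q a≤b = +-mono-≤ a≤b (m≤n+m Q Q)

    +Q≤+3Q : ∀ {a b} → a ≤ b → a + Q ≤ b + (Q + (Q + Q))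
    +Q≤+3Q a≤b = +-mono-≤ a≤b (m≤m+n Q (Q + Q))

    +2Q≤+3Q : ∀ {a b} → a ≤ b → a + (Q + Q) ≤ b + (Q + (Q + Q))
    +2Q≤+3Q a≤b = +-mono-≤ a≤b (m≤n+m (Q + Q) Q)

    <p : ∀ {t} → t ≤ 10 + (Q + (Q + Q)) → t < p
    <p t≤ = subst (_ <_) (sym p≡) (s≤s t≤)

    4+Q≤5+2Q : 4 + Q ≤ 5 + (Q + Q)
    4+Q≤5+2Q = +Q≤+2Q (≤ᵇ⇒≤ 4 5 _)

    toℕ-⟦3+Q⟧ : toℕ ⟦ 3 + Q ⟧ ≡ 3 + Q
    toℕ-⟦3+Q⟧ = toℕ-⟦⟧ (<p (+Q≤+3Q (≤ᵇ⇒≤ 3 10 _)))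

    toℕ-⟦5+Q⟧ : toℕ ⟦ 5 + Q ⟧ ≡ 5 + Q
    toℕ-⟦5+Q⟧ = toℕ-⟦⟧ (<p (+Q≤+3Q (≤ᵇ⇒≤ 5 10 _)))

    toℕ-⟦7+2Q⟧ : toℕ ⟦ 7 + (Q + Q) ⟧ ≡ 7 + (Q + Q)
    toℕ-⟦7+2Q⟧ = toℕ-⟦⟧ (<p (+2Q≤+3Q (≤ᵇ⇒≤ 7 10 _)))

    toℕ-⟦8+2Q⟧ : toℕ ⟦ 8 + (Q + Q) ⟧ ≡ 8 + (Q + Q)
    toℕ-⟦8+2Q⟧ = toℕ-⟦⟧ (<p (+2Q≤+3Q (≤ᵇ⇒≤ 8 10 _)))

    toℕ-⟦p-1⟧ : toℕ ⟦ 10 + (Q + (Q + Q)) ⟧ ≡ 10 + (Q + (Q + Q))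
    toℕ-⟦p-1⟧ = toℕ-⟦⟧ (<p ≤-refl)

    toℕ-⟦3+Q⟧+toℕ-⟦8+2Q⟧≡p : toℕ ⟦ 3 + Q ⟧ + toℕ ⟦ 8 + (Q + Q) ⟧ ≡ p
    toℕ-⟦3+Q⟧+toℕ-⟦8+2Q⟧≡p = begin
      toℕ ⟦ 3 + Q ⟧ + toℕ ⟦ 8 + (Q + Q) ⟧  ≡⟨ cong₂ _+_ toℕ-⟦3+Q⟧ toℕ-⟦8+2Q⟧ ⟩
      3 + Q + (8 + (Q + Q))                ≡⟨ solve [ Q ] ⟩
      11 + (Q + (Q + Q))                   ≡⟨ p≡ ⟨
      p                                    ∎
      where open ≡-Reasoning

    toℕ-⟦p-1⟧+toℕ-⟦1⟧≡p : toℕ ⟦ 10 + (Q + (Q + Q)) ⟧ + toℕ ⟦ 1 ⟧ ≡ p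
    toℕ-⟦p-1⟧+toℕ-⟦1⟧≡p = begin
      toℕ ⟦ 10 + (Q + (Q + Q)) ⟧ + toℕ ⟦ 1 ⟧  ≡⟨ cong₂ _+_ toℕ-⟦p-1⟧ (toℕ-⟦⟧ (<p z<s)) ⟩
      10 + (Q + (Q + Q)) + 1                  ≡⟨ solve [ Q ] ⟩
      11 + (Q + (Q + Q))                      ≡⟨ p≡ ⟨
      p                                       ∎
      where open ≡-Reasoning

  lowEnds highEnds budget middle : ℕ → Bool
  lowEnds  t = t ∈[ 3 + Q , 4 + Q ]
  highEnds t = t ∈[ 6 + (Q + Q) , 7 + (Q + Q) ]
  budget   t = t ∈[ 3 + Q , 5 + (Q + Q) ]
  middle   t = t ∈[ 4 + Q , 7 + (Q + Q) ]

  Middle : ∀ n → BSubset p (suc n)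
  Middle n x = middle (toℕ (head x))

  Middle-sumFree : ∀ n → SumFree p (Middle n)
  Middle-sumFree n (a ∷ _) (b ∷ _) a∈ b∈ with ∈[]-bounds a∈ | ∈[]-bounds b∈ | toℕ a + toℕ b <? p
  ... | 4+Q≤a , _ | 4+Q≤b , _ | yes no-wrap = ∈[]-above (begin-strict
    7 + (Q + Q)          <⟨ n<1+n _ ⟩
    8 + (Q + Q)          ≡⟨ solve [ Q ] ⟩
    (4 + Q) + (4 + Q)    ≤⟨ +-mono-≤ 4+Q≤a 4+Q≤b ⟩
    toℕ a + toℕ b        ≡⟨ toℕ-⊕-< a b no-wrap ⟨
    toℕ (a ⊕ b)          ∎)
    where open ≤-Reasoning
  ... | _ , a≤7+2Q | _ , b≤7+2Q | no wrap = ∈[]-below (+-cancelʳ-< p _ _ (begin-strict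
    toℕ (a ⊕ b) + p                     ≡⟨ toℕ-⊕-≥ a b (≮⇒≥ wrap) ⟩
    toℕ a + toℕ b                       ≤⟨ +-mono-≤ a≤7+2Q b≤7+2Q ⟩
    (7 + (Q + Q)) + (7 + (Q + Q))       ≡⟨ solve [ Q ] ⟩
    (3 + Q) + (11 + (Q + (Q + Q)))      ≡⟨ cong ((3 + Q) +_) p≡ ⟨
    (3 + Q) + p                         <⟨ +-monoˡ-< p (n<1+n _) ⟩
    (4 + Q) + p                         ∎))
    where open ≤-Reasoning

  highEnds-⊕⇒lowEnds : ∀ a → highEnds (toℕ (a ⊕ ⟦ 3 + Q ⟧)) ≡ true → lowEnds (toℕ a) ≡ true
  highEnds-⊕⇒lowEnds a t∈ with ∈[]-bounds t∈ | toℕ a + toℕ ⟦ 3 + Q ⟧ <? p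
  ... | 6+2Q≤ , ≤7+2Q | yes no-wrap = ∈[]-intro
    (+-cancelʳ-≤ (3 + Q) _ _ (begin
      (3 + Q) + (3 + Q)         ≡⟨ solve [ Q ] ⟩
      6 + (Q + Q)               ≤⟨ 6+2Q≤ ⟩
      toℕ (a ⊕ ⟦ 3 + Q ⟧)       ≡⟨ toℕ-a⊕ ⟩
      toℕ a + (3 + Q)           ∎))
    (+-cancelʳ-≤ (3 + Q) _ _ (begin
      toℕ a + (3 + Q)           ≡⟨ toℕ-a⊕ ⟨
      toℕ (a ⊕ ⟦ 3 + Q ⟧)       ≤⟨ ≤7+2Q ⟩
      7 + (Q + Q)               ≡⟨ solve [ Q ] ⟩
      (4 + Q) + (3 + Q)         ∎))
    where
    open ≤-Reasoning
    toℕ-a⊕ : toℕ (a ⊕ ⟦ 3 + Q ⟧) ≡ toℕ a + (3 + Q)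
    toℕ-a⊕ = trans (toℕ-⊕-< a _ no-wrap) (cong (toℕ a +_) toℕ-⟦3+Q⟧)
  ... | 6+2Q≤ , _ | no wrap = ⊥-elim (<⇒≱
    (subst (toℕ (a ⊕ ⟦ 3 + Q ⟧) <_) toℕ-⟦3+Q⟧ (toℕ-⊕-wrap a ⟦ 3 + Q ⟧ (≮⇒≥ wrap)))
    (≤-trans (+Q≤+2Q (≤ᵇ⇒≤ 3 6 _)) 6+2Q≤))

  budget-⊕⇒middle : ∀ a → budget (toℕ (a ⊕ ⟦ 10 + (Q + (Q + Q)) ⟧)) ≡ true → middle (toℕ a) ≡ true
  budget-⊕⇒middle a t∈ with ∈[]-bounds t∈ | toℕ a + toℕ ⟦ 10 + (Q + (Q + Q)) ⟧ <? p
  ... | _ , ≤5+2Q | yes no-wrap = ⊥-elim (<⇒≱ (≤-<-trans ≤5+2Q (s≤s (+2Q≤+3Q (≤ᵇ⇒≤ 5 9 _))))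
    (subst (_ ≤_) (sym (trans (toℕ-⊕-< a _ no-wrap) (cong (toℕ a +_) toℕ-⟦p-1⟧))) (m≤n+m _ (toℕ a))))
  ... | 3+Q≤ , ≤5+2Q | no wrap = ∈[]-intro
    (subst (4 + Q ≤_) 1+t≡a (s≤s 3+Q≤))
    (subst (_≤ 7 + (Q + Q)) 1+t≡a (s≤s (≤-trans ≤5+2Q (n≤1+n _))))
    where
    open ≡-Reasoning
    t = toℕ (a ⊕ ⟦ 10 + (Q + (Q + Q)) ⟧)
    1+t≡a : suc t ≡ toℕ a
    1+t≡a = +-cancelʳ-≡ (10 + (Q + (Q + Q))) _ _ (begin
      suc t + (10 + (Q + (Q + Q)))   ≡⟨ +-suc t _ ⟨
      t + (11 + (Q + (Q + Q)))       ≡⟨ cong (t +_) p≡ ⟨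
      t + p                          ≡⟨ toℕ-⊕-≥ a _ (≮⇒≥ wrap) ⟩
      toℕ a + toℕ ⟦ 10 + (Q + (Q + Q)) ⟧ ≡⟨ cong (toℕ a +_) toℕ-⟦p-1⟧ ⟩
      toℕ a + (10 + (Q + (Q + Q)))   ∎)

  budget-⊕-top : budget (toℕ (⟦ 7 + (Q + Q) ⟧ ⊕ ⟦ 10 + (Q + (Q + Q)) ⟧)) ≡ false
  budget-⊕-top = ∈[]-above (≤-reflexive (sym toℕ-top⊕))
    where
    open ≡-Reasoning
    sum≡ : toℕ ⟦ 7 + (Q + Q) ⟧ + toℕ ⟦ 10 + (Q + (Q + Q)) ⟧ ≡ 6 + (Q + Q) + p
    sum≡ = begin
      toℕ ⟦ 7 + (Q + Q) ⟧ + toℕ ⟦ 10 + (Q + (Q + Q)) ⟧  ≡⟨ cong₂ _+_ toℕ-⟦7+2Q⟧ toℕ-⟦p-1⟧ ⟩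
      7 + (Q + Q) + (10 + (Q + (Q + Q)))                 ≡⟨ solve [ Q ] ⟩
      6 + (Q + Q) + (11 + (Q + (Q + Q)))                 ≡⟨ cong (6 + (Q + Q) +_) p≡ ⟨
      6 + (Q + Q) + p                                    ∎
    toℕ-top⊕ : toℕ (⟦ 7 + (Q + Q) ⟧ ⊕ ⟦ 10 + (Q + (Q + Q)) ⟧) ≡ 6 + (Q + Q)
    toℕ-top⊕ = +-cancelʳ-≡ p _ _
      (trans (toℕ-⊕-≥ ⟦ 7 + (Q + Q) ⟧ ⟦ 10 + (Q + (Q + Q)) ⟧ (subst (p ≤_) (sym sum≡) (m≤n+m p _))) sum≡)

  middle-top : middle (toℕ ⟦ 7 + (Q + Q) ⟧) ≡ true
  middle-top = ∈[]-intro (subst (4 + Q ≤_) (sym toℕ-⟦7+2Q⟧) (+Q≤+2Q (≤ᵇ⇒≤ 4 7 _))) (≤-reflexive toℕ-⟦7+2Q⟧)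

  data Zone (t : ℕ) : Set where
    below   : t < 3 + Q → Zone t
    lowEnd  : 3 + Q ≤ t → t ≤ 4 + Q → Zone t
    slab    : 5 + Q ≤ t → t ≤ 5 + (Q + Q) → Zone t
    highEnd : 6 + (Q + Q) ≤ t → t ≤ 7 + (Q + Q) → Zone t
    above   : 7 + (Q + Q) < t → Zone t

  zone : ∀ t → Zone t
  zone t with t <? 3 + Q | t ≤? 4 + Q | t ≤? 5 + (Q + Q) | t ≤? 7 + (Q + Q)
  ... | yes t<3+Q | _         | _           | _           = below t<3+Q
  ... | no t≮3+Q  | yes t≤4+Q | _           | _           = lowEnd (≮⇒≥ t≮3+Q) t≤4+Q
  ... | no _      | no t≰4+Q  | yes t≤5+2Q | _           = slab (≰⇒> t≰4+Q) t≤5+2Q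
  ... | no _      | no _      | no t≰5+2Q  | yes t≤7+2Q = highEnd (≰⇒> t≰5+2Q) t≤7+2Q
  ... | no _      | no _      | no _        | no t≰7+2Q  = above (≰⇒> t≰7+2Q)

  module _ {n} (D : BSubset p (suc n)) (D-sumFree : SumFree p D)
           (D∋2m-1 : D (⟦ 3 + Q ⟧ ∷ 0V p n) ≡ true) (D∋2m : D (⟦ 4 + Q ⟧ ∷ 0V p n) ≡ true)
           (D⊇slab : ∀ {a} v → 5 + Q ≤ toℕ a → toℕ a ≤ 5 + (Q + Q) → D (a ∷ v) ≡ true) where

    D∋axis : ∀ {w} → 3 + Q ≤ toℕ w → toℕ w ≤ 5 + (Q + Q) → D (w ∷ 0V p n) ≡ true
    D∋axis {w} 3+Q≤w w≤5+2Q with toℕ w ≟ 3 + Q | toℕ w ≟ 4 + Q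
    ... | yes w≡3+Q | _        = subst (λ c → D (c ∷ 0V p n) ≡ true) (sym (toℕ≡⇒≡⟦⟧ w≡3+Q)) D∋2m-1
    ... | no _      | yes w≡4+Q = subst (λ c → D (c ∷ 0V p n) ≡ true) (sym (toℕ≡⇒≡⟦⟧ w≡4+Q)) D∋2m
    ... | no w≢3+Q  | no w≢4+Q = D⊇slab _ (≤∧≢⇒< (≤∧≢⇒< 3+Q≤w (w≢3+Q ∘ sym)) (w≢4+Q ∘ sym)) w≤5+2Q

    -- (t, v) + (5 + 2Q - t, 0) lies in the slab.
    D-below : ∀ {a} v → toℕ a < 3 + Q → D (a ∷ v) ≡ false
    D-below {a} v t<3+Q = sumFree-excludes D-sumFree (D∋axis 3+Q≤w w≤5+2Q)
      (D⊇slab (v ⊞ 0V p n) (subst (5 + Q ≤_) (sym toℕ-a⊕w) (+-monoʳ-≤ 5 (m≤n+m Q Q))) (≤-reflexive toℕ-a⊕w))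
      where
      t = toℕ a
      t≤5+2Q : t ≤ 5 + (Q + Q)
      t≤5+2Q = ≤-trans (<⇒≤ t<3+Q) (+Q≤+2Q (≤ᵇ⇒≤ 3 5 _))
      w = ⟦ 5 + (Q + Q) ∸ t ⟧
      toℕ-w : toℕ w ≡ 5 + (Q + Q) ∸ t
      toℕ-w = toℕ-⟦⟧ (≤-<-trans (m∸n≤m _ t) (<p (+2Q≤+3Q (≤ᵇ⇒≤ 5 10 _))))
      3+Q≤w : 3 + Q ≤ toℕ w
      3+Q≤w = subst₂ _≤_ (m+n∸n≡m (3 + Q) Q) (sym toℕ-w) (∸-monoʳ-≤ (5 + (Q + Q)) (s≤s⁻¹ t<3+Q))
      w≤5+2Q : toℕ w ≤ 5 + (Q + Q)
      w≤5+2Q = subst (_≤ 5 + (Q + Q)) (sym toℕ-w) (m∸n≤m _ t)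
      toℕ-a⊕w : toℕ (a ⊕ w) ≡ 5 + (Q + Q)
      toℕ-a⊕w = trans (toℕ-⊕-< a w (subst (_< p) (sym t+w≡) (<p (+2Q≤+3Q (≤ᵇ⇒≤ 5 10 _))))) t+w≡
        where
        t+w≡ : t + toℕ w ≡ 5 + (Q + Q)
        t+w≡ = trans (cong (t +_) toℕ-w) (m+[n∸m]≡n t≤5+2Q)

    -- (t, v) = (5 + Q, v) + (t - 5 - Q, 0), a sum of two elements of D.
    D-above : ∀ {a} v → 7 + (Q + Q) < toℕ a → D (a ∷ v) ≡ false
    D-above {a} v 7+2Q<t = subst (λ x → D x ≡ false) z⊞w≡a∷v
      (D-sumFree (z ∷ v) (w ∷ 0V p n)
        (D⊇slab v (≤-reflexive (sym toℕ-⟦5+Q⟧))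
                  (subst (_≤ 5 + (Q + Q)) (sym toℕ-⟦5+Q⟧) (+-monoʳ-≤ 5 (m≤n+m Q Q))))
        (D∋axis 3+Q≤w w≤5+2Q))
      where
      t = toℕ a
      z = ⟦ 5 + Q ⟧
      5+Q≤t : 5 + Q ≤ t
      5+Q≤t = ≤-trans (+Q≤+2Q (≤ᵇ⇒≤ 5 8 _)) 7+2Q<t
      w = ⟦ t ∸ (5 + Q) ⟧
      toℕ-w : toℕ w ≡ t ∸ (5 + Q)
      toℕ-w = toℕ-⟦⟧ (≤-<-trans (m∸n≤m t (5 + Q)) (toℕ<n a))
      3+Q≤w : 3 + Q ≤ toℕ w
      3+Q≤w = subst₂ _≤_ (m+n∸n≡m (3 + Q) Q) (sym toℕ-w) (∸-monoˡ-≤ (5 + Q) 7+2Q<t)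
      w≤5+2Q : toℕ w ≤ 5 + (Q + Q)
      w≤5+2Q = subst (_≤ 5 + (Q + Q)) (sym toℕ-w) (m≤n+o⇒m∸n≤o t (5 + Q) (begin
        t                                ≤⟨ s≤s⁻¹ (subst (t <_) p≡ (toℕ<n a)) ⟩
        10 + (Q + (Q + Q))               ≡⟨ solve [ Q ] ⟩
        (5 + Q) + (5 + (Q + Q))          ∎))
        where open ≤-Reasoning
      z⊞w≡a∷v : (z ∷ v) ⊞ (w ∷ 0V p n) ≡ a ∷ v
      z⊞w≡a∷v = cong₂ _∷_ (toℕ-injective (trans (toℕ-⊕-< z w (subst (_< p) (sym z+w≡t) (toℕ<n a))) z+w≡t))
                          (⊞-identityʳ v)
        where
        z+w≡t : toℕ z + toℕ w ≡ t
        z+w≡t = trans (cong₂ _+_ toℕ-⟦5+Q⟧ toℕ-w) (m+[n∸m]≡n 5+Q≤t)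

    b : V p (suc n)
    b = ⟦ 3 + Q ⟧ ∷ 0V p n

    lowPartner highPart inBudget : V p (suc n) → ℕ
    lowPartner x = ind (lowEnds (toℕ (head x)) ∧ D (x ⊞ b))
    highPart   x = ind (highEnds (toℕ (head x)) ∧ D x)
    inBudget   x = ind (budget (toℕ (head x)))

    pointwise : ∀ x → ind (D x) + lowPartner x ≤ inBudget x + highPart x
    pointwise (a ∷ v) with zone (toℕ a)
    ... | below t<3+Q rewrite D-below v t<3+Q | ∈[]-below {hi = 4 + Q} t<3+Q = z≤n
    ... | lowEnd 3+Q≤t t≤4+Q
      rewrite ∈[]-intro 3+Q≤t t≤4+Q | ∈[]-intro 3+Q≤t (≤-trans t≤4+Q 4+Q≤5+2Q)
            | ∈[]-below {hi = 7 + (Q + Q)} (s≤s (≤-trans t≤4+Q 4+Q≤5+2Q))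
      with D (a ∷ v) in Dx
    ...   | false = ind≤1 _
    ...   | true rewrite D-sumFree (a ∷ v) b Dx D∋2m-1 = ≤-refl
    pointwise (a ∷ v) | slab 5+Q≤t t≤5+2Q
      rewrite ∈[]-above {lo = 3 + Q} 5+Q≤t | ∈[]-intro (≤-trans (+-monoˡ-≤ Q (≤ᵇ⇒≤ 3 5 _)) 5+Q≤t) t≤5+2Q
            | ∈[]-below {hi = 7 + (Q + Q)} (s≤s t≤5+2Q)
      = +-monoˡ-≤ 0 (ind≤1 _)
    pointwise (a ∷ v) | highEnd 6+2Q≤t t≤7+2Q
      rewrite ∈[]-above {lo = 3 + Q} (≤-trans (+Q≤+2Q (≤ᵇ⇒≤ 5 6 _)) 6+2Q≤t) | ∈[]-above {lo = 3 + Q} 6+2Q≤t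
            | ∈[]-intro 6+2Q≤t t≤7+2Q
      = ≤-reflexive (+-identityʳ _)
    pointwise (a ∷ v) | above 7+2Q<t
      rewrite D-above v 7+2Q<t | ∈[]-above {lo = 3 + Q} (≤-trans (+Q≤+2Q (≤ᵇ⇒≤ 5 8 _)) 7+2Q<t) = z≤n

    total : (V p (suc n) → ℕ) → ℕ
    total f = sum (map f (allV p (suc n)))

    highPart≤lowPartner : total highPart ≤ total lowPartner
    highPart≤lowPartner = begin
      total highPart
        ≡⟨ sum-allV-translate (axisPoint-⊞-≡0 ⟦ 3 + Q ⟧ ⟦ 8 + (Q + Q) ⟧ toℕ-⟦3+Q⟧+toℕ-⟦8+2Q⟧≡p) highPart ⟩
      total (λ x → highPart (x ⊞ b))
        ≤⟨ sum-map-mono (allV p (suc n)) (λ { (a ∷ _) → ind-∧-mono _ (highEnds-⊕⇒lowEnds a) }) ⟩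
      total lowPartner
        ∎
      where open ≤-Reasoning

    card≤budget : card p D ≤ total inBudget
    card≤budget = +-cancelʳ-≤ (total lowPartner) _ _ (begin
      card p D + total lowPartner                ≡⟨ sum-map-+ (allV p (suc n)) (ind ∘ D) lowPartner ⟨
      total (λ x → ind (D x) + lowPartner x)     ≤⟨ sum-map-mono (allV p (suc n)) pointwise ⟩
      total (λ x → inBudget x + highPart x)      ≡⟨ sum-map-+ (allV p (suc n)) inBudget highPart ⟩
      total inBudget + total highPart            ≤⟨ +-monoʳ-≤ _ highPart≤lowPartner ⟩
      total inBudget + total lowPartner          ∎)
      where open ≤-Reasoning

    budget<Middle : total inBudget < card p (Middle n)
    budget<Middle = begin-strict
      total inBudget
        ≡⟨ sum-allV-translate (axisPoint-⊞-≡0 u ⟦ 1 ⟧ toℕ-⟦p-1⟧+toℕ-⟦1⟧≡p) inBudget ⟩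
      total (λ x → inBudget (x ⊞ u′))
        <⟨ sum-map-mono-< (λ { (a ∷ _) → ind-mono (budget-⊕⇒middle a) }) (∈-allV (⟦ 7 + (Q + Q) ⟧ ∷ 0V p n)) top ⟩
      card p (Middle n)
        ∎
      where
      open ≤-Reasoning
      u = ⟦ 10 + (Q + (Q + Q)) ⟧
      u′ : V p (suc n)
      u′ = u ∷ 0V p n
      top : ind (budget (toℕ (⟦ 7 + (Q + Q) ⟧ ⊕ u))) < ind (middle (toℕ ⟦ 7 + (Q + Q) ⟧))
      top rewrite budget-⊕-top | middle-top = s≤s z≤n

    card<Middle : card p D < card p (Middle n)
    card<Middle = ≤-<-trans card≤budget budget<Middle

module _ (p : ℕ) .{{_ : NonZero p}} (q : ℕ) {k : ℕ} (P : V p k → Set) where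
  open Fpⁿ p

  private
    2m≡ : 2 * (2 + q) ≡ 4 + (q + q)
    2m≡ = solve [ q ]

    2m+1≡ : 2 * (2 + q) + 1 ≡ 5 + (q + q)
    2m+1≡ = solve [ q ]

    4m≡ : 4 * (2 + q) ≡ 8 + ((q + q) + (q + q))
    4m≡ = solve [ q ]

  VSModel∋2m-1 : VSModel p (2 + q) k P (⟦ 3 + (q + q) ⟧ ∷ 0V p k)
  VSModel∋2m-1 = inj₁ (cong (λ i → ⟦ i ∸ 1 ⟧) (sym 2m≡) , refl)

  VSModel∋2m : ZeroNotInSumset p P → VSModel p (2 + q) k P (⟦ 4 + (q + q) ⟧ ∷ 0V p k)
  VSModel∋2m P+P∌0 = inj₂ (inj₁ (cong ⟦_⟧ (sym 2m≡) , λ P0 → P+P∌0 _ _ P0 P0 (⊞-identityʳ (0V p k))))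

  VSModel⊇slab : ∀ {a} v → 5 + (q + q) ≤ toℕ a → toℕ a ≤ 5 + ((q + q) + (q + q)) →
                 VSModel p (2 + q) k P (a ∷ v)
  VSModel⊇slab {a} v lo hi = inj₂ (inj₂ (inj₁
    (toℕ a , subst (_≤ toℕ a) (sym 2m+1≡) lo , subst (toℕ a ≤_) (cong (_∸ 3) (sym 4m≡)) hi , sym (⟦toℕ⟧ a))))

p+1≡6m⇒m≡2+q : ∀ {m p} → p + 1 ≡ 6 * m → 11 ≤ p →
               ∃[ q ] m ≡ 2 + q × p ≡ 11 + ((q + q) + ((q + q) + (q + q)))
p+1≡6m⇒m≡2+q {m} {p} p+1≡6m 11≤p with m | trans (+-comm 1 p) p+1≡6m
... | zero        | ()
... | suc zero    | refl = ⊥-elim (<⇒≱ (≤ᵇ⇒≤ 6 11 _) 11≤p)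
... | suc (suc q) | 1+p≡6m = q , refl , suc-injective (trans 1+p≡6m (solve [ q ]))

lemma3p2 : (m p : ℕ) .{{_ : NonZero p}} → Prime p → p + 1 ≡ 6 * m → 11 ≤ p →
    (n : ℕ) → 1 ≤ n → (A : V p n → Set) → Structured p m n A →
    ¬ (Σ (BSubset p n) λ B → MaxSumFree p B × (∀ x → A x → B x ≡ true))
lemma3p2 m p _ p+1≡6m 11≤p n _ A (k , r , refl , B , (P , P+P∌0 , χ , B≅M) , φ , A≅B)
         (S , (S-sumFree , S-maximum) , A⊆S)
  with p+1≡6m⇒m≡2+q {m} p+1≡6m 11≤p | Fpⁿ.⊇iso-product⇒∘Aut-⊇product p {M = VSModel p m k P} φ χ A≅B B≅M A⊆S
... | q , refl , p≡ | ψ , M×Fʳ⊆S∘ψ = <⇒≱ card-D<card-Middle card-Middle≤card-D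
  where
  open Fpⁿ p
  open MiddleThird p (q + q) p≡
  D : BSubset p (suc k + r)
  D = S ∘ Aut.fun ψ
  D∋axisPoint : ∀ {c} → VSModel p (2 + q) k P (c ∷ 0V p k) → D (c ∷ 0V p (k + r)) ≡ true
  D∋axisPoint {c} Mc = M×Fʳ⊆S∘ψ _ (subst (λ v → VSModel p (2 + q) k P (c ∷ v)) (sym (take-replicate k _)) Mc)
  card-D<card-Middle : card p D < card p (Middle (k + r))
  card-D<card-Middle = card<Middle D (sumFree-∘Aut ψ S-sumFree)
    (D∋axisPoint (VSModel∋2m-1 p q P)) (D∋axisPoint (VSModel∋2m p q P P+P∌0))
    (λ v lo hi → M×Fʳ⊆S∘ψ _ (VSModel⊇slab p q P _ lo hi))
  card-Middle≤card-D : card p (Middle (k + r)) ≤ card p D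
  card-Middle≤card-D =
    subst (card p (Middle (k + r)) ≤_) (sym (card-∘Aut ψ S)) (S-maximum _ (Middle-sumFree (k + r)))
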